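{- Let $p$ be an arbitrary set-function on $S$ with $p(\emptyset)=0$, let $B=B'(p)$, and let $m$ be an integral element of $B$. Then for every integral vector $\pi\in\mathbb{Z}^S$, $$\sum_{s\in S}m(s)^2\ \ge\ \hat p(\pi)-\sum_{s\in S}\left\lfloor\frac{\pi(s)}{2}\right\rfloor\left\lceil\frac{\pi(s)}{2}\right\rceil.$$ Furthermore, equality holds for $m$ and $\pi$ if and only if (O1) $m(s)\in\{\lfloor\pi(s)/2\rfloor,\lceil\pi(s)/2\rceil\}$ for every $s\in S$, and (O2) every strict $\pi$-top set $X$ satisfies $\widetilde m(X)=p(X)$.
   Context: $S$ is a finite non-empty set of $n$ elements, $p$ real-valued on subsets of $S$. $B'(p)=\{x\in\mathbb{R}^S:\widetilde x(S)=p(S),\ \widetilde x(Z)\ge p(Z)\ \forall Z\subset S\}$, $\widetilde x(Z)=\sum_{s\in Z}x(s)$. Linear extension: for $\pi\in\mathbb{R}^S$, index $S=\{s_1,\dots,s_n\}$ so that $\pi(s_1)\ge\dots\ge\pi(s_n)$ (ties arbitrarily), let $I_j=\{s_1,\dots,s_j\}$ and $\hat p(\pi):=p(I_n)\pi(s_n)+\sum_{j=1}^{n-1}p(I_j)[\pi(s_j)-\pi(s_{j+1})]$. A non-empty set $X\subseteq S$ is a strict $\pi$-top set if $\pi(u)>\pi(v)$ whenever $u\in X$, $v\in S-X$.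
   Formalization: The set-function p takes rational values instead of real values. -}

module Defs where

open import Data.Nat as ℕ using (ℕ; zero; suc)
open import Data.Fin using (Fin; zero; suc; toℕ; inject₁; fromℕ)
open import Data.Fin.Subset using (Subset; _∈_; _∉_; Nonempty)
open import Data.Fin.Permutation using (Permutation′; _⟨$⟩ʳ_; _⟨$⟩ˡ_)
open import Data.Integer as ℤ using (ℤ)
open import Data.Rational using (ℚ; 0ℚ; _+_; _-_; _*_; _≤_; floor; ceiling; _/_)
  renaming (_<_ to _<ℚ_)
open import Data.Bool using (Bool; true; false; if_then_else_)
open import Data.Vec using (tabulate; lookup)
open import Data.Product using (_×_)
open import Data.Sum using (_⊎_)
open import Relation.Binary.PropositionalEquality using (_≡_)

⟦_⟧ : ℤ → ℚ
⟦ z ⟧ = z / 1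

sumFin : ∀ {k} → (Fin k → ℚ) → ℚ
sumFin {zero} f = 0ℚ
sumFin {suc k} f = f zero + sumFin (λ i → f (suc i))

-- set functions on S = Fin n
SetFun : ℕ → Set
SetFun n = Subset n → ℚ

tilde : ∀ {n} → (Fin n → ℤ) → Subset n → ℚ
tilde x Z = sumFin (λ i → if lookup Z i then ⟦ x i ⟧ else 0ℚ)

InB' : ∀ {n} → SetFun n → (Fin n → ℤ) → Set
InB' {n} p x = (tilde x Data.Fin.Subset.⊤ ≡ p Data.Fin.Subset.⊤)
             × (∀ (Z : Subset n) → p Z ≤ tilde x Z)

-- σ lists the elements s_1,…,s_n (as σ 0, …, σ (n-1)) in non-increasing order of π
SortsDesc : ∀ {n} → (Fin n → ℤ) → Permutation′ n → Set
SortsDesc {n} π σ = ∀ (i j : Fin n) → toℕ i ℕ.≤ toℕ j → π (σ ⟨$⟩ʳ j) ℤ.≤ π (σ ⟨$⟩ʳ i)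

initSeg : ∀ {n} → Permutation′ n → ℕ → Subset n
initSeg σ k = tabulate (λ s → toℕ (σ ⟨$⟩ˡ s) ℕ.<ᵇ k)

linExt : ∀ {n} → SetFun (suc n) → Permutation′ (suc n) → (Fin (suc n) → ℤ) → ℚ
linExt {n} p σ π =
  p (initSeg σ (suc n)) * ⟦ π (σ ⟨$⟩ʳ fromℕ n) ⟧
  + sumFin {n} (λ k → p (initSeg σ (suc (toℕ k)))
                  * (⟦ π (σ ⟨$⟩ʳ inject₁ k) ⟧ - ⟦ π (σ ⟨$⟩ʳ suc k) ⟧))

half⌊⌋ half⌈⌉ : ℤ → ℤ
half⌊⌋ z = floor (z / 2)
half⌈⌉ z = ceiling (z / 2)

StrictTop : ∀ {n} → (Fin n → ℤ) → Subset n → Set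
StrictTop π X = Nonempty X × (∀ u v → u ∈ X → v ∉ X → π v ℤ.< π u)

sqSum : ∀ {n} → (Fin n → ℤ) → ℚ
sqSum m = sumFin (λ s → ⟦ m s ℤ.* m s ⟧)

corr : ∀ {n} → (Fin n → ℤ) → ℚ
corr π = sumFin (λ s → ⟦ half⌊⌋ (π s) ℤ.* half⌈⌉ (π s) ⟧)

O1 : ∀ {n} → (Fin n → ℤ) → (Fin n → ℤ) → Set
O1 m π = ∀ s → (m s ≡ half⌊⌋ (π s)) ⊎ (m s ≡ half⌈⌉ (π s))

O2 : ∀ {n} → SetFun n → (Fin n → ℤ) → (Fin n → ℤ) → Set
O2 {n} p m π = ∀ (X : Subset n) → StrictTop π X → tilde m X ≡ p X

{-# OPTIONS --safe #-}
-- For integers m and z, m² − m z + ⌊z/2⌋⌈z/2⌉ = (m − ⌊z/2⌋)(m − ⌈z/2⌉), which is nonnegative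
-- because no integer lies strictly between ⌊z/2⌋ and ⌈z/2⌉, and vanishes iff m is one of them.
-- Summation by parts along s₁,…,sₙ turns Σ m(s)π(s) into the linear extension of the modular
-- function m̃, so with m̃(S) = p(S)
--   Σ m(s)² − (p̂(π) − Σ ⌊π(s)/2⌋⌈π(s)/2⌉)
--     = Σ_s (m(s) − ⌊π(s)/2⌋)(m(s) − ⌈π(s)/2⌉) + Σ_j (m̃(I_j) − p(I_j))(π(s_j) − π(s_{j+1})).
-- For m ∈ B'(p) every term on the right is nonnegative.  Equality forces all of them to vanish:
-- the first sum gives (O1); the second says m̃(I_j) = p(I_j) wherever π drops strictly after s_j,
-- and these I_j together with S are exactly the strict π-top sets, which gives (O2).
module Submission where

open import Defs
open import Data.Bool using (Bool; true; false; if_then_else_)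
open import Data.Empty using (⊥-elim)
open import Data.Fin using (Fin; zero; suc; toℕ; inject₁; fromℕ)
open import Data.Fin.Permutation using (Permutation′; _⟨$⟩ʳ_; _⟨$⟩ˡ_; inverseʳ; inverseˡ)
open import Data.Fin.Subset using (Subset; _∈_; _∉_; ⊤)
open import Data.Integer as ℤ using (ℤ)
import Data.Integer.Properties as ℤ
open import Data.Nat as ℕ using (ℕ; zero; suc)
import Data.Nat.Properties as ℕ
open import Data.Product using (_×_; _,_; proj₁; proj₂; ∃-syntax)
open import Data.Rational as ℚ using (ℚ; mkℚ; ↥_; ↧_; 0ℚ; 1ℚ; floor)
import Data.Rational.Properties as ℚ
open import Data.Sum as Sum using (_⊎_; inj₁; inj₂)
open import Function.Base using (_∘_)
open import Function.Bundles using (_⇔_; mk⇔; Equivalence)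
open import Relation.Binary.PropositionalEquality
open import Relation.Nullary using (Dec; yes; no; ¬_)

module _ where
  import Data.Nat.Coprimality as Coprimality
  open import Data.Rational using (_+_; _*_; _≤_)

  ⟦⟧≡mkℚ : ∀ z → ⟦ z ⟧ ≡ mkℚ z 0 (Coprimality.sym (Coprimality.1-coprimeTo _))
  ⟦⟧≡mkℚ z = ℚ.↥p/↧p≡p _

  ⟦⟧-homo-+ : ∀ a b → ⟦ a ℤ.+ b ⟧ ≡ ⟦ a ⟧ + ⟦ b ⟧
  ⟦⟧-homo-+ a b rewrite ⟦⟧≡mkℚ a | ⟦⟧≡mkℚ b =
    cong (ℚ._/ 1) (sym (cong₂ ℤ._+_ (ℤ.*-identityʳ a) (ℤ.*-identityʳ b)))

  ⟦⟧-homo-* : ∀ a b → ⟦ a ℤ.* b ⟧ ≡ ⟦ a ⟧ * ⟦ b ⟧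
  ⟦⟧-homo-* a b rewrite ⟦⟧≡mkℚ a | ⟦⟧≡mkℚ b = refl

  ⟦⟧-mono-≤ : ∀ {a b} → a ℤ.≤ b → ⟦ a ⟧ ≤ ⟦ b ⟧
  ⟦⟧-mono-≤ {a} {b} a≤b rewrite ⟦⟧≡mkℚ a | ⟦⟧≡mkℚ b =
    ℚ.*≤* (subst₂ ℤ._≤_ (sym (ℤ.*-identityʳ a)) (sym (ℤ.*-identityʳ b)) a≤b)

  ⟦⟧-injective : ∀ {a b} → ⟦ a ⟧ ≡ ⟦ b ⟧ → a ≡ b
  ⟦⟧-injective {a} {b} eq = trans (sym (↥⟦⟧ a)) (trans (cong ↥_ eq) (↥⟦⟧ b))
    where
    ↥⟦⟧ : ∀ z → ↥ ⟦ z ⟧ ≡ z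
    ↥⟦⟧ z = cong ↥_ (⟦⟧≡mkℚ z)

-- Halves of an integer

module _ where
  open import Data.Integer using (+_; +0; +[1+_]; -[1+_]; 0ℤ; 1ℤ; _+_; _-_; _*_; -_; _≤_; _<_; _≤?_)
  open import Data.Integer.DivMod using (_%_; a≡a%n+[a/n]*n; n%d<d)
  open import Data.Integer.GCD using (gcd)
  open import Data.Integer.Tactic.RingSolver using (solve-∀)
  open ≡-Reasoning

  0≤i<2⇒i≡0⊎i≡1 : ∀ {i} → 0ℤ ≤ i → i < + 2 → i ≡ 0ℤ ⊎ i ≡ 1ℤ
  0≤i<2⇒i≡0⊎i≡1 {+0}           _ _ = inj₁ refl
  0≤i<2⇒i≡0⊎i≡1 {+[1+ 0 ]}     _ _ = inj₂ refl
  0≤i<2⇒i≡0⊎i≡1 {+[1+ suc _ ]} _ (ℤ.+<+ (ℕ.s≤s (ℕ.s≤s ())))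

  2*i≢1 : ∀ i → + 2 * i ≢ 1ℤ
  2*i≢1 +0 ()
  2*i≢1 +[1+ k ] eq = ℕ.m+1+n≢0 k (ℕ.suc-injective (ℤ.+-injective eq))
  2*i≢1 -[1+ _ ] ()

  -- Division with remainder, ↥ q = r + ⌊q⌋ ↧ q with 0 ≤ r < ↧ q, turns the hypothesis
  -- into (z − 2⌊q⌋) ↧ q = 2r.
  z-2⌊q⌋≡0∨1 : ∀ z q → ↥ q * + 2 ≡ z * ↧ q → z - + 2 * floor q ≡ 0ℤ ⊎ z - + 2 * floor q ≡ 1ℤ
  z-2⌊q⌋≡0∨1 z q@record{} q≡z/2 = 0≤i<2⇒i≡0⊎i≡1 0≤e e<2
    where
    d = ↧ q
    f = floor q
    e = z - + 2 * f
    e*d≡r*2 : e * d ≡ + (↥ q % d) * + 2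
    e*d≡r*2 = begin
      e * d                              ≡⟨ expand z f d ⟩
      z * d - + 2 * f * d                ≡⟨ cong (_- + 2 * f * d) q≡z/2 ⟨
      ↥ q * + 2 - + 2 * f * d            ≡⟨ cong (λ x → x * + 2 - + 2 * f * d) (a≡a%n+[a/n]*n (↥ q) d) ⟩
      (+ (↥ q % d) + f * d) * + 2 - + 2 * f * d  ≡⟨ cancel (+ (↥ q % d)) f d ⟩
      + (↥ q % d) * + 2                  ∎
      where
      expand : ∀ z f d → (z - + 2 * f) * d ≡ z * d - + 2 * f * d
      expand = solve-∀
      cancel : ∀ r f d → (r + f * d) * + 2 - + 2 * f * d ≡ r * + 2
      cancel = solve-∀
    0≤e : 0ℤ ≤ e
    0≤e = ℤ.*-cancelʳ-≤-pos 0ℤ e d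
            (subst (0ℤ ≤_) (trans (ℤ.pos-* (↥ q % d) 2) (sym e*d≡r*2)) (ℤ.+≤+ ℕ.z≤n))
    e<2 : e < + 2
    e<2 = ℤ.*-cancelʳ-<-nonNeg d (subst₂ _<_ (sym e*d≡r*2) (ℤ.*-comm d (+ 2))
            (ℤ.*-monoʳ-<-pos (+ 2) (ℤ.+<+ (n%d<d (↥ q) d))))

  ↥-half : ∀ z → ↥ (z ℚ./ 2) * + 2 ≡ z * ↧ (z ℚ./ 2)
  ↥-half z = begin
    ↥ q * + 2             ≡⟨ cong (↥ q *_) (ℚ.↧-/ z 2) ⟨
    ↥ q * (↧ q * g)       ≡⟨ regroup (↥ q) (↧ q) g ⟩
    ↥ q * g * ↧ q         ≡⟨ cong (_* ↧ q) (ℚ.↥-/ z 2) ⟩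
    z * ↧ q               ∎
    where
    q = z ℚ./ 2
    g = gcd z (+ 2)
    regroup : ∀ a b g → a * (b * g) ≡ a * g * b
    regroup = solve-∀

  ↥-neg-half : ∀ z q → ↥ q * + 2 ≡ z * ↧ q → ↥ (ℚ.- q) * + 2 ≡ - z * ↧ (ℚ.- q)
  ↥-neg-half z q q≡z/2 = begin
    ↥ (ℚ.- q) * + 2       ≡⟨ cong (_* + 2) (ℚ.↥-neg q) ⟩
    - ↥ q * + 2           ≡⟨ ℤ.neg-distribˡ-* (↥ q) (+ 2) ⟨
    - (↥ q * + 2)         ≡⟨ cong -_ q≡z/2 ⟩
    - (z * ↧ q)           ≡⟨ ℤ.neg-distribˡ-* z (↧ q) ⟩
    - z * ↧ q             ≡⟨ cong (- z *_) (ℚ.↧-neg q) ⟨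
    - z * ↧ (ℚ.- q)       ∎

  ceiling≡-floor-neg : ∀ q → ℚ.ceiling q ≡ - floor (ℚ.- q)
  ceiling≡-floor-neg record{} = refl

  bits-with-even-sum-agree : ∀ {a b} x → a ≡ 0ℤ ⊎ a ≡ 1ℤ → b ≡ 0ℤ ⊎ b ≡ 1ℤ →
                             + 2 * x ≡ a + b → a ≡ b
  bits-with-even-sum-agree x (inj₁ refl) (inj₁ refl) _     = refl
  bits-with-even-sum-agree x (inj₂ refl) (inj₂ refl) _     = refl
  bits-with-even-sum-agree x (inj₁ refl) (inj₂ refl) 2x≡1 = ⊥-elim (2*i≢1 x 2x≡1)
  bits-with-even-sum-agree x (inj₂ refl) (inj₁ refl) 2x≡1 = ⊥-elim (2*i≢1 x 2x≡1)

  z-2half⌊⌋≡0∨1 : ∀ z → z - + 2 * half⌊⌋ z ≡ 0ℤ ⊎ z - + 2 * half⌊⌋ z ≡ 1ℤ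
  z-2half⌊⌋≡0∨1 z = z-2⌊q⌋≡0∨1 z (z ℚ./ 2) (↥-half z)

  -- As ⌈z/2⌉ = −⌊−z/2⌋, the bits a = z − 2⌊z/2⌋ and b = −z − 2⌊−z/2⌋ satisfy
  -- 2(⌈z/2⌉ − ⌊z/2⌋) = a + b, which forces a = b.
  half⌈⌉≡half⌊⌋+parity : ∀ z → half⌈⌉ z ≡ half⌊⌋ z + (z - + 2 * half⌊⌋ z)
  half⌈⌉≡half⌊⌋+parity z = ℤ.*-cancelˡ-≡ (+ 2) c (f + a) (begin
    + 2 * c                     ≡⟨ split c f ⟩
    + 2 * f + + 2 * (c - f)     ≡⟨ cong (ℤ._+_ (+ 2 * f)) 2[c-f]≡a+b ⟩
    + 2 * f + (a + b)           ≡⟨ cong (λ x → + 2 * f + (a + x)) a≡b ⟨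
    + 2 * f + (a + a)           ≡⟨ double f a ⟩
    + 2 * (f + a)               ∎)
    where
    f = half⌊⌋ z
    f⁻ = floor (ℚ.- (z ℚ./ 2))
    c = half⌈⌉ z
    a = z - + 2 * f
    b = - z - + 2 * f⁻
    2[c-f]≡a+b : + 2 * (c - f) ≡ a + b
    2[c-f]≡a+b = trans (cong (λ c → + 2 * (c - f)) (ceiling≡-floor-neg (z ℚ./ 2))) (identity z f f⁻)
      where
      identity : ∀ z f f⁻ → + 2 * (- f⁻ - f) ≡ (z - + 2 * f) + (- z - + 2 * f⁻)
      identity = solve-∀
    a≡b : a ≡ b
    a≡b = bits-with-even-sum-agree (c - f)
            (z-2half⌊⌋≡0∨1 z)
            (z-2⌊q⌋≡0∨1 (- z) (ℚ.- (z ℚ./ 2)) (↥-neg-half z (z ℚ./ 2) (↥-half z)))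
            2[c-f]≡a+b
    split : ∀ c f → + 2 * c ≡ + 2 * f + + 2 * (c - f)
    split = solve-∀
    double : ∀ f a → + 2 * f + (a + a) ≡ + 2 * (f + a)
    double = solve-∀

  half⌊⌋+half⌈⌉≡id : ∀ z → half⌊⌋ z + half⌈⌉ z ≡ z
  half⌊⌋+half⌈⌉≡id z = begin
    f + half⌈⌉ z              ≡⟨ cong (ℤ._+_ f) (half⌈⌉≡half⌊⌋+parity z) ⟩
    f + (f + (z - + 2 * f))   ≡⟨ cancel z f ⟩
    z                         ∎
    where
    f = half⌊⌋ z
    cancel : ∀ z f → f + (f + (z - + 2 * f)) ≡ z
    cancel = solve-∀

  half⌈⌉≡half⌊⌋∨suc : ∀ z → half⌈⌉ z ≡ half⌊⌋ z ⊎ half⌈⌉ z ≡ ℤ.suc (half⌊⌋ z)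
  half⌈⌉≡half⌊⌋∨suc z = Sum.map
    (λ a≡0 → trans c≡f+a (trans (cong (ℤ._+_ f) a≡0) (ℤ.+-identityʳ f)))
    (λ a≡1 → trans c≡f+a (trans (cong (ℤ._+_ f) a≡1) (ℤ.+-comm f 1ℤ)))
    (z-2half⌊⌋≡0∨1 z)
    where
    f = half⌊⌋ z
    c≡f+a = half⌈⌉≡half⌊⌋+parity z

  half⌊⌋≤half⌈⌉ : ∀ z → half⌊⌋ z ≤ half⌈⌉ z
  half⌊⌋≤half⌈⌉ z with half⌈⌉≡half⌊⌋∨suc z
  ... | inj₁ c≡f   = ℤ.≤-reflexive (sym c≡f)
  ... | inj₂ c≡1+f = subst (half⌊⌋ z ≤_) (sym c≡1+f) (ℤ.i≤suc[i] (half⌊⌋ z))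

  ≤half⌊⌋∨half⌈⌉≤ : ∀ m z → m ≤ half⌊⌋ z ⊎ half⌈⌉ z ≤ m
  ≤half⌊⌋∨half⌈⌉≤ m z with m ≤? half⌊⌋ z | half⌈⌉≡half⌊⌋∨suc z
  ... | yes m≤f | _          = inj₁ m≤f
  ... | no  m≰f | inj₁ c≡f   = inj₂ (subst (_≤ m) (sym c≡f) (ℤ.<⇒≤ (ℤ.≰⇒> m≰f)))
  ... | no  m≰f | inj₂ c≡1+f = inj₂ (subst (_≤ m) (sym c≡1+f) (ℤ.i<j⇒suc[i]≤j (ℤ.≰⇒> m≰f)))

  0≤*-sameSign : ∀ {i j} → (i ≤ 0ℤ × j ≤ 0ℤ) ⊎ (0ℤ ≤ i × 0ℤ ≤ j) → 0ℤ ≤ i * j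
  0≤*-sameSign {i} {j} (inj₁ (i≤0 , j≤0)) =
    subst (_≤ i * j) (ℤ.*-zeroˡ j) (ℤ.*-monoʳ-≤-nonPos j {{ℤ.nonPositive j≤0}} i≤0)
  0≤*-sameSign {i} {j} (inj₂ (0≤i , 0≤j)) =
    subst (_≤ i * j) (ℤ.*-zeroˡ j) (ℤ.*-monoʳ-≤-nonNeg j {{ℤ.nonNegative 0≤j}} 0≤i)

  halfDefect : ℤ → ℤ → ℤ
  halfDefect m z = (m - half⌊⌋ z) * (m - half⌈⌉ z)

  halfDefect-nonNeg : ∀ m z → 0ℤ ≤ halfDefect m z
  halfDefect-nonNeg m z with ≤half⌊⌋∨half⌈⌉≤ m z
  ... | inj₁ m≤f = 0≤*-sameSign (inj₁ (ℤ.i≤j⇒i-j≤0 m≤f , ℤ.i≤j⇒i-j≤0 (ℤ.≤-trans m≤f f≤c)))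
    where f≤c = half⌊⌋≤half⌈⌉ z
  ... | inj₂ c≤m = 0≤*-sameSign (inj₂ (ℤ.i≤j⇒0≤j-i (ℤ.≤-trans f≤c c≤m) , ℤ.i≤j⇒0≤j-i c≤m))
    where f≤c = half⌊⌋≤half⌈⌉ z

  halfDefect≡0⇔ : ∀ m z → halfDefect m z ≡ 0ℤ ⇔ (m ≡ half⌊⌋ z ⊎ m ≡ half⌈⌉ z)
  halfDefect≡0⇔ m z = mk⇔ to from
    where
    to : halfDefect m z ≡ 0ℤ → m ≡ half⌊⌋ z ⊎ m ≡ half⌈⌉ z
    to eq with ℤ.i*j≡0⇒i≡0∨j≡0 (m - half⌊⌋ z) eq
    ... | inj₁ m-f≡0 = inj₁ (ℤ.i-j≡0⇒i≡j m (half⌊⌋ z) m-f≡0)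
    ... | inj₂ m-c≡0 = inj₂ (ℤ.i-j≡0⇒i≡j m (half⌈⌉ z) m-c≡0)
    from : m ≡ half⌊⌋ z ⊎ m ≡ half⌈⌉ z → halfDefect m z ≡ 0ℤ
    from (inj₁ refl) = trans (cong (_* (m - half⌈⌉ z)) (ℤ.+-inverseʳ m)) (ℤ.*-zeroˡ (m - half⌈⌉ z))
    from (inj₂ refl) = trans (cong ((m - half⌊⌋ z) *_) (ℤ.+-inverseʳ m)) (ℤ.*-zeroʳ (m - half⌊⌋ z))

  m*m+⌊⌋*⌈⌉≡halfDefect+m*z : ∀ m z → m * m + half⌊⌋ z * half⌈⌉ z ≡ halfDefect m z + m * z
  m*m+⌊⌋*⌈⌉≡halfDefect+m*z m z = begin
    m * m + f * c                ≡⟨ expand m f c ⟩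
    halfDefect m z + m * (f + c) ≡⟨ cong (λ x → halfDefect m z + m * x) (half⌊⌋+half⌈⌉≡id z) ⟩
    halfDefect m z + m * z       ∎
    where
    f = half⌊⌋ z
    c = half⌈⌉ z
    expand : ∀ m f c → m * m + f * c ≡ (m - f) * (m - c) + m * (f + c)
    expand = solve-∀

module _ where
  open import Data.Rational using (_+_; _-_; _*_; _≤_; -_; 1/_; ≢-nonZero)
  open import Algebra.Properties.Group ℚ.+-0-group using (identityʳ-unique)
  open ≡-Reasoning

  0≤q-p : ∀ {p q} → p ≤ q → 0ℚ ≤ q - p
  0≤q-p {p} {q} p≤q = subst (_≤ q - p) (ℚ.+-inverseʳ p) (ℚ.+-monoˡ-≤ (- p) p≤q)

  p≤p+q : ∀ p {q} → 0ℚ ≤ q → p ≤ p + q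
  p≤p+q p 0≤q = subst (_≤ p + _) (ℚ.+-identityʳ p) (ℚ.+-monoʳ-≤ p 0≤q)

  p*q≡0⇒p≡0 : ∀ {p q} → p * q ≡ 0ℚ → q ≢ 0ℚ → p ≡ 0ℚ
  p*q≡0⇒p≡0 {p} {q} pq≡0 q≢0 = begin
    p                  ≡⟨ ℚ.*-identityʳ p ⟨
    p * 1ℚ             ≡⟨ cong (p *_) (ℚ.*-inverseʳ q) ⟨
    p * (q * q⁻¹)      ≡⟨ ℚ.*-assoc p q q⁻¹ ⟨
    p * q * q⁻¹        ≡⟨ cong (_* q⁻¹) pq≡0 ⟩
    0ℚ * q⁻¹           ≡⟨ ℚ.*-zeroˡ q⁻¹ ⟩
    0ℚ                 ∎
    where
    instance _ = ≢-nonZero q≢0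
    q⁻¹ = 1/ q

  x≡y+d⇒[x≡y⇔d≡0] : ∀ {x y d} → x ≡ y + d → x ≡ y ⇔ d ≡ 0ℚ
  x≡y+d⇒[x≡y⇔d≡0] {x} {y} {d} x≡y+d = mk⇔
    (λ x≡y → identityʳ-unique y d (trans (sym x≡y+d) x≡y))
    (λ { refl → trans x≡y+d (ℚ.+-identityʳ y) })

  p+q≡0⇔p≡0×q≡0 : ∀ {p q} → 0ℚ ≤ p → 0ℚ ≤ q → p + q ≡ 0ℚ ⇔ (p ≡ 0ℚ × q ≡ 0ℚ)
  p+q≡0⇔p≡0×q≡0 {p} {q} 0≤p 0≤q = mk⇔
    (λ p+q≡0 → p≡0 0≤p 0≤q p+q≡0 , p≡0 0≤q 0≤p (trans (ℚ.+-comm q p) p+q≡0))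
    (λ { (refl , refl) → refl })
    where
    p≡0 : ∀ {p q} → 0ℚ ≤ p → 0ℚ ≤ q → p + q ≡ 0ℚ → p ≡ 0ℚ
    p≡0 {p} {q} 0≤p 0≤q p+q≡0 =
      ℚ.≤-antisym (subst₂ _≤_ (ℚ.+-identityʳ p) p+q≡0 (ℚ.+-monoʳ-≤ p 0≤q)) 0≤p

module _ where
  open import Data.Rational using (_+_; _-_; _*_; _≤_)
  open import Algebra.Bundles using (Ring)
  open import Algebra.Properties.Semiring.Sum (Ring.semiring ℚ.+-*-ring)
    using (sum; sum-cong-≗; ∑-distrib-+; ∑-comm; *-distribˡ-sum; *-distribʳ-sum)
  open ≡-Reasoning

  sumFin≡sum : ∀ {k} (f : Fin k → ℚ) → sumFin f ≡ sum f
  sumFin≡sum {zero}  f = refl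
  sumFin≡sum {suc k} f = cong (f zero +_) (sumFin≡sum (λ i → f (suc i)))

  sumFin-cong : ∀ {k} {f g : Fin k → ℚ} → (∀ i → f i ≡ g i) → sumFin f ≡ sumFin g
  sumFin-cong {f = f} {g} f≗g = begin
    sumFin f ≡⟨ sumFin≡sum f ⟩ sum f ≡⟨ sum-cong-≗ f≗g ⟩ sum g ≡⟨ sumFin≡sum g ⟨ sumFin g ∎

  sumFin-distrib-+ : ∀ {k} (f g : Fin k → ℚ) → sumFin (λ i → f i + g i) ≡ sumFin f + sumFin g
  sumFin-distrib-+ f g = begin
    sumFin (λ i → f i + g i) ≡⟨ sumFin≡sum (λ i → f i + g i) ⟩
    sum (λ i → f i + g i)    ≡⟨ ∑-distrib-+ f g ⟩
    sum f + sum g            ≡⟨ cong₂ _+_ (sumFin≡sum f) (sumFin≡sum g) ⟨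
    sumFin f + sumFin g      ∎

  *-distribˡ-sumFin : ∀ {k} x (f : Fin k → ℚ) → x * sumFin f ≡ sumFin (λ i → x * f i)
  *-distribˡ-sumFin x f = begin
    x * sumFin f             ≡⟨ cong (x *_) (sumFin≡sum f) ⟩
    x * sum f                ≡⟨ *-distribˡ-sum x f ⟩
    sum (λ i → x * f i)      ≡⟨ sumFin≡sum (λ i → x * f i) ⟨
    sumFin (λ i → x * f i)   ∎

  *-distribʳ-sumFin : ∀ {k} x (f : Fin k → ℚ) → sumFin f * x ≡ sumFin (λ i → f i * x)
  *-distribʳ-sumFin x f = begin
    sumFin f * x             ≡⟨ cong (_* x) (sumFin≡sum f) ⟩
    sum f * x                ≡⟨ *-distribʳ-sum x f ⟩
    sum (λ i → f i * x)      ≡⟨ sumFin≡sum (λ i → f i * x) ⟨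
    sumFin (λ i → f i * x)   ∎

  sumFin-comm : ∀ {k l} (f : Fin k → Fin l → ℚ) →
                sumFin (λ i → sumFin (f i)) ≡ sumFin (λ j → sumFin (λ i → f i j))
  sumFin-comm f = begin
    sumFin (λ i → sumFin (f i))            ≡⟨ sumFin-cong (λ i → sumFin≡sum (f i)) ⟩
    sumFin (λ i → sum (f i))               ≡⟨ sumFin≡sum (λ i → sum (f i)) ⟩
    sum (λ i → sum (f i))                  ≡⟨ ∑-comm f ⟩
    sum (λ j → sum (λ i → f i j))          ≡⟨ sumFin≡sum (λ j → sum (λ i → f i j)) ⟨
    sumFin (λ j → sum (λ i → f i j))       ≡⟨ sumFin-cong (λ j → sumFin≡sum (λ i → f i j)) ⟨
    sumFin (λ j → sumFin (λ i → f i j))    ∎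

  sumFin-nonNeg : ∀ {k} (f : Fin k → ℚ) → (∀ i → 0ℚ ≤ f i) → 0ℚ ≤ sumFin f
  sumFin-nonNeg {zero}  f 0≤f = ℚ.≤-refl
  sumFin-nonNeg {suc k} f 0≤f = ℚ.+-mono-≤ (0≤f zero) (sumFin-nonNeg (λ i → f (suc i)) (λ i → 0≤f (suc i)))

  sumFin≡0⇔ : ∀ {k} (f : Fin k → ℚ) → (∀ i → 0ℚ ≤ f i) → sumFin f ≡ 0ℚ ⇔ (∀ i → f i ≡ 0ℚ)
  sumFin≡0⇔ {zero}  f 0≤f = mk⇔ (λ _ ()) (λ _ → refl)
  sumFin≡0⇔ {suc k} f 0≤f = mk⇔
    (λ { Σ≡0 zero    → proj₁ (Equivalence.to head+tail Σ≡0)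
       ; Σ≡0 (suc i) → Equivalence.to tail (proj₂ (Equivalence.to head+tail Σ≡0)) i })
    (λ f≡0 → Equivalence.from head+tail (f≡0 zero , Equivalence.from tail (λ i → f≡0 (suc i))))
    where
    tail = sumFin≡0⇔ (λ i → f (suc i)) (λ i → 0≤f (suc i))
    head+tail = p+q≡0⇔p≡0×q≡0 (0≤f zero) (sumFin-nonNeg (λ i → f (suc i)) (λ i → 0≤f (suc i)))

-- Initial segments and summation by parts

module _ where
  open import Data.Vec.Properties using (lookup∘tabulate; []=⇒lookup; lookup⇒[]=)
  open import Data.Bool.Properties using (T-≡)
  open import Data.Fin.Properties using (toℕ<n)
  open import Data.Fin.Subset.Properties using (⊆-antisym; ⊆⊤)

  ∈initSeg⇔ : ∀ {n} (σ : Permutation′ n) j s → s ∈ initSeg σ j ⇔ toℕ (σ ⟨$⟩ˡ s) ℕ.< j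
  ∈initSeg⇔ σ j s = mk⇔
    (λ s∈ → ℕ.<ᵇ⇒< _ j (Equivalence.from T-≡ (trans (sym (lookup∘tabulate rank<j s)) ([]=⇒lookup s∈))))
    (λ lt → lookup⇒[]= s (initSeg σ j) (trans (lookup∘tabulate rank<j s) (Equivalence.to T-≡ (ℕ.<⇒<ᵇ lt))))
    where
    rank<j = λ s → toℕ (σ ⟨$⟩ˡ s) ℕ.<ᵇ j

  initSeg-full : ∀ {n} (σ : Permutation′ n) → initSeg σ n ≡ ⊤
  initSeg-full σ = ⊆-antisym ⊆⊤ (λ {s} _ → Equivalence.from (∈initSeg⇔ σ _ s) (toℕ<n (σ ⟨$⟩ˡ s)))

module _ where
  open import Data.Rational using (_+_; _-_; _*_)
  open import Data.Rational.Solver using (module +-*-Solver)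
  open import Data.Vec.Properties using (lookup∘tabulate; lookup-replicate)
  open +-*-Solver hiding (⟦_⟧)
  open ≡-Reasoning

  χ : Bool → ℚ
  χ true  = 1ℚ
  χ false = 0ℚ

  if-then-else-0≡χ* : ∀ b x → (if b then x else 0ℚ) ≡ χ b * x
  if-then-else-0≡χ* true  x = sym (ℚ.*-identityˡ x)
  if-then-else-0≡χ* false x = sym (ℚ.*-zeroˡ x)

  telescope : ∀ {n} (a : Fin (suc n) → ℚ) i →
              a i ≡ a (fromℕ n) + sumFin (λ k → χ (toℕ i ℕ.<ᵇ suc (toℕ k)) * (a (inject₁ k) - a (suc k)))
  telescope {zero}  a zero    = sym (ℚ.+-identityʳ (a zero))
  telescope {suc n} a zero    = begin
    a zero                           ≡⟨ solve 2 (λ x y → x := (x :- y) :+ y) refl (a zero) (a (suc zero)) ⟩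
    (a zero - a (suc zero)) + a (suc zero)  ≡⟨ cong ((a zero - a (suc zero)) +_) (telescope (λ i → a (suc i)) zero) ⟩
    (a zero - a (suc zero)) + (L + S)       ≡⟨ solve 3 (λ x l s → x :+ (l :+ s) := l :+ (con 1ℚ :* x :+ s)) refl
                                                        (a zero - a (suc zero)) L S ⟩
    L + (1ℚ * (a zero - a (suc zero)) + S)  ∎
    where
    L = a (suc (fromℕ n))
    S = sumFin (λ k → 1ℚ * (a (suc (inject₁ k)) - a (suc (suc k))))
  telescope {suc n} a (suc i) = begin
    a (suc i)                                ≡⟨ telescope (λ i → a (suc i)) i ⟩
    L + S                                    ≡⟨ solve 3 (λ x l s → l :+ s := l :+ (con 0ℚ :* x :+ s)) refl
                                                         (a zero - a (suc zero)) L S ⟩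
    L + (0ℚ * (a zero - a (suc zero)) + S)  ∎
    where
    L = a (suc (fromℕ n))
    S = sumFin (λ k → χ (toℕ i ℕ.<ᵇ suc (toℕ k)) * (a (suc (inject₁ k)) - a (suc (suc k))))

  -- The indicator of r s ≤ k is written χ (toℕ (r s) <ᵇ suc (toℕ k)), the form in which initSeg is defined.
  summation-by-parts : ∀ {m n} (w : Fin m → ℚ) (r : Fin m → Fin (suc n)) (a : Fin (suc n) → ℚ) →
    sumFin (λ s → w s * a (r s)) ≡
    sumFin w * a (fromℕ n)
      + sumFin (λ k → sumFin (λ s → χ (toℕ (r s) ℕ.<ᵇ suc (toℕ k)) * w s) * (a (inject₁ k) - a (suc k)))
  summation-by-parts {n = n} w r a = begin
    sumFin (λ s → w s * a (r s))
      ≡⟨ sumFin-cong (λ s → cong (w s *_) (telescope a (r s))) ⟩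
    sumFin (λ s → w s * (L + sumFin (λ k → [ s ≤ k ] * d k)))
      ≡⟨ sumFin-cong (λ s → expand s) ⟩
    sumFin (λ s → w s * L + sumFin (λ k → [ s ≤ k ] * w s * d k))
      ≡⟨ sumFin-distrib-+ (λ s → w s * L) (λ s → sumFin (λ k → [ s ≤ k ] * w s * d k)) ⟩
    sumFin (λ s → w s * L) + sumFin (λ s → sumFin (λ k → [ s ≤ k ] * w s * d k))
      ≡⟨ cong₂ _+_ (*-distribʳ-sumFin L w) (sumFin-comm (λ k s → [ s ≤ k ] * w s * d k)) ⟨
    sumFin w * L + sumFin (λ k → sumFin (λ s → [ s ≤ k ] * w s * d k))
      ≡⟨ cong (sumFin w * L +_) (sumFin-cong (λ k → *-distribʳ-sumFin (d k) (λ s → [ s ≤ k ] * w s))) ⟨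
    sumFin w * L + sumFin (λ k → sumFin (λ s → [ s ≤ k ] * w s) * d k)
      ∎
    where
    L = a (fromℕ n)
    d = λ k → a (inject₁ k) - a (suc k)
    [_≤_] = λ s k → χ (toℕ (r s) ℕ.<ᵇ suc (toℕ k))
    expand : ∀ s → w s * (L + sumFin (λ k → [ s ≤ k ] * d k)) ≡ w s * L + sumFin (λ k → [ s ≤ k ] * w s * d k)
    expand s = begin
      w s * (L + sumFin (λ k → [ s ≤ k ] * d k))
        ≡⟨ ℚ.*-distribˡ-+ (w s) L _ ⟩
      w s * L + w s * sumFin (λ k → [ s ≤ k ] * d k)
        ≡⟨ cong (w s * L +_) (*-distribˡ-sumFin (w s) (λ k → [ s ≤ k ] * d k)) ⟩
      w s * L + sumFin (λ k → w s * ([ s ≤ k ] * d k))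
        ≡⟨ cong (w s * L +_) (sumFin-cong (λ k →
             solve 3 (λ x c y → x :* (c :* y) := c :* x :* y) refl (w s) ([ s ≤ k ]) (d k))) ⟩
      w s * L + sumFin (λ k → [ s ≤ k ] * w s * d k)
        ∎

  tilde-⊤ : ∀ {n} (x : Fin n → ℤ) → tilde x ⊤ ≡ sumFin (λ s → ⟦ x s ⟧)
  tilde-⊤ x = sumFin-cong (λ s → cong (λ b → if b then ⟦ x s ⟧ else 0ℚ) (lookup-replicate s true))

  tilde-initSeg : ∀ {n} (x : Fin n → ℤ) σ j →
                  tilde x (initSeg σ j) ≡ sumFin (λ s → χ (toℕ (σ ⟨$⟩ˡ s) ℕ.<ᵇ j) * ⟦ x s ⟧)
  tilde-initSeg x σ j = sumFin-cong (λ s → trans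
    (cong (λ b → if b then ⟦ x s ⟧ else 0ℚ) (lookup∘tabulate (λ s → toℕ (σ ⟨$⟩ˡ s) ℕ.<ᵇ j) s))
    (if-then-else-0≡χ* _ (⟦ x s ⟧)))

  gap : ∀ {n} → (Fin (suc n) → ℤ) → Permutation′ (suc n) → Fin n → ℚ
  gap π σ k = ⟦ π (σ ⟨$⟩ʳ inject₁ k) ⟧ - ⟦ π (σ ⟨$⟩ʳ suc k) ⟧

  linExt-tilde : ∀ {n} (x : Fin (suc n) → ℤ) σ π → linExt (tilde x) σ π ≡ sumFin (λ s → ⟦ x s ⟧ * ⟦ π s ⟧)
  linExt-tilde {n} x σ π = begin
    linExt (tilde x) σ π
      ≡⟨ cong₂ _+_ (cong (_* a (fromℕ n)) (trans (cong (tilde x) (initSeg-full σ)) (tilde-⊤ x)))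
                   (sumFin-cong (λ k → cong (_* d k) (tilde-initSeg x σ (suc (toℕ k))))) ⟩
    sumFin (λ s → ⟦ x s ⟧) * a (fromℕ n)
      + sumFin (λ k → sumFin (λ s → χ (toℕ (σ ⟨$⟩ˡ s) ℕ.<ᵇ suc (toℕ k)) * ⟦ x s ⟧) * d k)
      ≡⟨ summation-by-parts (λ s → ⟦ x s ⟧) (σ ⟨$⟩ˡ_) a ⟨
    sumFin (λ s → ⟦ x s ⟧ * a (σ ⟨$⟩ˡ s))
      ≡⟨ sumFin-cong (λ s → cong (λ t → ⟦ x s ⟧ * ⟦ π t ⟧) (inverseʳ σ {s})) ⟩
    sumFin (λ s → ⟦ x s ⟧ * ⟦ π s ⟧)
      ∎
    where
    a : Fin (suc n) → ℚ
    a k = ⟦ π (σ ⟨$⟩ʳ k) ⟧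
    d : Fin n → ℚ
    d k = a (inject₁ k) - a (suc k)

  linExt-cong : ∀ {n} {p q : SetFun (suc n)} σ π → (∀ Z → p Z ≡ q Z) → linExt p σ π ≡ linExt q σ π
  linExt-cong {n} σ π p≗q = cong₂ _+_
    (cong (_* ⟦ π (σ ⟨$⟩ʳ fromℕ n) ⟧) (p≗q (initSeg σ (suc n))))
    (sumFin-cong (λ k → cong (_* gap π σ k) (p≗q (initSeg σ (suc (toℕ k))))))

  linExt-+ : ∀ {n} (p q : SetFun (suc n)) σ π →
             linExt (λ Z → p Z + q Z) σ π ≡ linExt p σ π + linExt q σ π
  linExt-+ {n} p q σ π = begin
    (p S + q S) * L + sumFin (λ k → (p (I k) + q (I k)) * d k)
      ≡⟨ cong₂ _+_ (ℚ.*-distribʳ-+ L (p S) (q S))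
                   (trans (sumFin-cong (λ k → ℚ.*-distribʳ-+ (d k) (p (I k)) (q (I k))))
                          (sumFin-distrib-+ (λ k → p (I k) * d k) (λ k → q (I k) * d k))) ⟩
    (p S * L + q S * L) + (sumFin (λ k → p (I k) * d k) + sumFin (λ k → q (I k) * d k))
      ≡⟨ solve 4 (λ a b c e → (a :+ b) :+ (c :+ e) := (a :+ c) :+ (b :+ e)) refl
                 (p S * L) (q S * L) (sumFin (λ k → p (I k) * d k)) (sumFin (λ k → q (I k) * d k)) ⟩
    linExt p σ π + linExt q σ π
      ∎
    where
    S = initSeg σ (suc n)
    I = λ (k : Fin n) → initSeg σ (suc (toℕ k))
    L = ⟦ π (σ ⟨$⟩ʳ fromℕ n) ⟧
    d = gap π σ

-- Strict top sets along a sorting permutation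

everywhere⊎¬zero⊎turnsFalse : ∀ {n p} {P : Fin (suc n) → Set p} → (∀ i → Dec (P i)) →
  (∀ i → P i) ⊎ ¬ P zero ⊎ ∃[ k ] (P (inject₁ k) × ¬ P (suc k))
everywhere⊎¬zero⊎turnsFalse {zero} P? with P? zero
... | yes P0 = inj₁ (λ { zero → P0 })
... | no ¬P0 = inj₂ (inj₁ ¬P0)
everywhere⊎¬zero⊎turnsFalse {suc n} P? with P? zero | everywhere⊎¬zero⊎turnsFalse (λ i → P? (suc i))
... | no ¬P0 | _                             = inj₂ (inj₁ ¬P0)
... | yes P0 | inj₁ P∘suc                    = inj₁ (λ { zero → P0 ; (suc i) → P∘suc i })
... | yes P0 | inj₂ (inj₁ ¬P1)               = inj₂ (inj₂ (zero , P0 , ¬P1))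
... | yes P0 | inj₂ (inj₂ (k , Pk , ¬Pk+1)) = inj₂ (inj₂ (suc k , Pk , ¬Pk+1))

module _ {n} (π : Fin (suc n) → ℤ) (σ : Permutation′ (suc n)) (sorted : SortsDesc π σ) where
  open import Data.Fin.Properties using (toℕ-inject₁)
  open import Data.Fin.Subset using (_⊆_)
  open import Data.Fin.Subset.Properties using (_∈?_; ⊆-antisym; ⊆⊤)
  open import Data.Rational using (_+_; _*_; _≤_)
  open import Algebra.Properties.Group ℚ.+-0-group using (x∙y⁻¹≈ε⇒x≈y; x≈y⇒x∙y⁻¹≈ε)

  private
    rank : Fin (suc n) → Fin (suc n)
    rank s = σ ⟨$⟩ˡ s

    π-rank : ∀ s → π (σ ⟨$⟩ʳ rank s) ≡ π s
    π-rank s = cong π (inverseʳ σ)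

  initSeg-strictTop : ∀ k → π (σ ⟨$⟩ʳ suc k) ℤ.< π (σ ⟨$⟩ʳ inject₁ k) →
                      StrictTop π (initSeg σ (suc (toℕ k)))
  initSeg-strictTop k drop = (σ ⟨$⟩ʳ zero , σ0∈I) , separates
    where
    I = initSeg σ (suc (toℕ k))
    σ0∈I : σ ⟨$⟩ʳ zero ∈ I
    σ0∈I = Equivalence.from (∈initSeg⇔ σ _ _)
             (subst (λ i → toℕ i ℕ.< suc (toℕ k)) (sym (inverseˡ σ)) (ℕ.s≤s ℕ.z≤n))
    separates : ∀ u v → u ∈ I → v ∉ I → π v ℤ.< π u
    separates u v u∈I v∉I = begin-strict
      π v                        ≡⟨ π-rank v ⟨
      π (σ ⟨$⟩ʳ rank v)          ≤⟨ sorted (suc k) (rank v) k<rank-v ⟩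
      π (σ ⟨$⟩ʳ suc k)           <⟨ drop ⟩
      π (σ ⟨$⟩ʳ inject₁ k)       ≤⟨ sorted (rank u) (inject₁ k) rank-u≤k ⟩
      π (σ ⟨$⟩ʳ rank u)          ≡⟨ π-rank u ⟩
      π u                        ∎
      where
      open ℤ.≤-Reasoning
      k<rank-v : toℕ k ℕ.< toℕ (rank v)
      k<rank-v = ℕ.≮⇒≥ (v∉I ∘ Equivalence.from (∈initSeg⇔ σ _ v))
      rank-u≤k : toℕ (rank u) ℕ.≤ toℕ (inject₁ k)
      rank-u≤k = subst (toℕ (rank u) ℕ.≤_) (sym (toℕ-inject₁ k))
                   (ℕ.s≤s⁻¹ (Equivalence.to (∈initSeg⇔ σ _ u) u∈I))

  strictTop-downClosed : ∀ {X} → StrictTop π X →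
                         ∀ {i j} → toℕ i ℕ.≤ toℕ j → σ ⟨$⟩ʳ j ∈ X → σ ⟨$⟩ʳ i ∈ X
  strictTop-downClosed {X} (_ , separates) {i} {j} i≤j σj∈X with σ ⟨$⟩ʳ i ∈? X
  ... | yes σi∈X = σi∈X
  ... | no  σi∉X = ⊥-elim (ℤ.<⇒≱ (separates _ _ σj∈X σi∉X) (sorted i j i≤j))

  strictTop⇒⊤⊎initSeg : ∀ {X} → StrictTop π X →
    X ≡ ⊤ ⊎ ∃[ k ] (π (σ ⟨$⟩ʳ suc k) ℤ.< π (σ ⟨$⟩ʳ inject₁ k) × X ≡ initSeg σ (suc (toℕ k)))
  strictTop⇒⊤⊎initSeg {X} top@((u , u∈X) , separates) with everywhere⊎¬zero⊎turnsFalse (λ i → σ ⟨$⟩ʳ i ∈? X)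
  ... | inj₁ σ∈X = inj₁ (⊆-antisym ⊆⊤ (λ {s} _ → subst (_∈ X) (inverseʳ σ) (σ∈X (rank s))))
  ... | inj₂ (inj₁ σ0∉X) = ⊥-elim (σ0∉X (strictTop-downClosed top ℕ.z≤n (subst (_∈ X) (sym (inverseʳ σ)) u∈X)))
  ... | inj₂ (inj₂ (k , σk∈X , σk+1∉X)) = inj₂ (k , separates _ _ σk∈X σk+1∉X , ⊆-antisym X⊆I I⊆X)
    where
    I = initSeg σ (suc (toℕ k))
    X⊆I : X ⊆ I
    X⊆I {s} s∈X = Equivalence.from (∈initSeg⇔ σ _ s) (ℕ.≰⇒> λ k<rank →
      σk+1∉X (strictTop-downClosed top k<rank (subst (_∈ X) (sym (inverseʳ σ)) s∈X)))
    I⊆X : I ⊆ X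
    I⊆X {s} s∈I = subst (_∈ X) (inverseʳ σ) (strictTop-downClosed top rank-s≤k σk∈X)
      where
      rank-s≤k : toℕ (rank s) ℕ.≤ toℕ (inject₁ k)
      rank-s≤k = subst (toℕ (rank s) ℕ.≤_) (sym (toℕ-inject₁ k))
                   (ℕ.s≤s⁻¹ (Equivalence.to (∈initSeg⇔ σ _ s) s∈I))

  sorted-step : ∀ k → π (σ ⟨$⟩ʳ suc k) ℤ.≤ π (σ ⟨$⟩ʳ inject₁ k)
  sorted-step k = sorted (inject₁ k) (suc k) (subst (ℕ._≤ suc (toℕ k)) (sym (toℕ-inject₁ k)) (ℕ.n≤1+n (toℕ k)))

  0≤gap : ∀ k → 0ℚ ≤ gap π σ k
  0≤gap k = 0≤q-p (⟦⟧-mono-≤ (sorted-step k))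

  drop⇒gap≢0 : ∀ k → π (σ ⟨$⟩ʳ suc k) ℤ.< π (σ ⟨$⟩ʳ inject₁ k) → gap π σ k ≢ 0ℚ
  drop⇒gap≢0 k drop gap≡0 = ℤ.<⇒≢ drop (sym (⟦⟧-injective (x∙y⁻¹≈ε⇒x≈y _ _ gap≡0)))

  ¬drop⇒gap≡0 : ∀ k → ¬ π (σ ⟨$⟩ʳ suc k) ℤ.< π (σ ⟨$⟩ʳ inject₁ k) → gap π σ k ≡ 0ℚ
  ¬drop⇒gap≡0 k ¬drop = x≈y⇒x∙y⁻¹≈ε (cong ⟦_⟧ (sym (ℤ.≤∧≮⇒≡ (sorted-step k) ¬drop)))

  module _ {q : SetFun (suc n)} (0≤q : ∀ Z → 0ℚ ≤ q Z) (q⊤≡0 : q ⊤ ≡ 0ℚ) where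
    private
      I : Fin n → Subset (suc n)
      I k = initSeg σ (suc (toℕ k))

      term : Fin n → ℚ
      term k = q (I k) * gap π σ k

      0≤term : ∀ k → 0ℚ ≤ term k
      0≤term k = ℚ.nonNegative⁻¹ (term k)
        {{ℚ.nonNeg*nonNeg⇒nonNeg (q (I k)) {{ℚ.nonNegative (0≤q (I k))}} (gap π σ k) {{ℚ.nonNegative (0≤gap k)}}}}

      linExt≡Σterm : linExt q σ π ≡ sumFin term
      linExt≡Σterm = begin
        q (initSeg σ (suc n)) * L + sumFin term  ≡⟨ cong (λ x → x * L + sumFin term) q[S]≡0 ⟩
        0ℚ * L + sumFin term                     ≡⟨ cong (_+ sumFin term) (ℚ.*-zeroˡ L) ⟩
        0ℚ + sumFin term                         ≡⟨ ℚ.+-identityˡ (sumFin term) ⟩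
        sumFin term                              ∎
        where
        open ≡-Reasoning
        L = ⟦ π (σ ⟨$⟩ʳ fromℕ n) ⟧
        q[S]≡0 = trans (cong q (initSeg-full σ)) q⊤≡0

    linExt-nonNeg : 0ℚ ≤ linExt q σ π
    linExt-nonNeg = subst (0ℚ ≤_) (sym linExt≡Σterm) (sumFin-nonNeg term 0≤term)

    linExt≡0⇔tight : linExt q σ π ≡ 0ℚ ⇔ (∀ X → StrictTop π X → q X ≡ 0ℚ)
    linExt≡0⇔tight = mk⇔ to from
      where
      terms≡0⇔ = sumFin≡0⇔ term 0≤term
      to : linExt q σ π ≡ 0ℚ → ∀ X → StrictTop π X → q X ≡ 0ℚ
      to N≡0 X top with strictTop⇒⊤⊎initSeg top
      ... | inj₁ refl              = q⊤≡0
      ... | inj₂ (k , drop , refl) =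
        p*q≡0⇒p≡0 (Equivalence.to terms≡0⇔ (trans (sym linExt≡Σterm) N≡0) k) (drop⇒gap≢0 k drop)
      from : (∀ X → StrictTop π X → q X ≡ 0ℚ) → linExt q σ π ≡ 0ℚ
      from tight = trans linExt≡Σterm (Equivalence.from terms≡0⇔ term≡0)
        where
        term≡0 : ∀ k → term k ≡ 0ℚ
        term≡0 k with π (σ ⟨$⟩ʳ suc k) ℤ.<? π (σ ⟨$⟩ʳ inject₁ k)
        ... | no ¬drop = trans (cong (q (I k) *_) (¬drop⇒gap≡0 k ¬drop)) (ℚ.*-zeroʳ (q (I k)))
        ... | yes drop =
          trans (cong (_* gap π σ k) (tight (I k) (initSeg-strictTop k drop))) (ℚ.*-zeroˡ (gap π σ k))

-- The defect decomposition

module _ where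
  open import Data.Rational using (_+_; _-_; _*_; _≤_)
  open import Data.Rational.Solver using (module +-*-Solver)
  open import Algebra.Properties.Group ℚ.+-0-group using (x∙y⁻¹≈ε⇒x≈y; x≈y⇒x∙y⁻¹≈ε)
  open +-*-Solver hiding (⟦_⟧)
  open ≡-Reasoning

  slack : ∀ {n} → SetFun n → (Fin n → ℤ) → SetFun n
  slack p m Z = tilde m Z - p Z

  totalHalfDefect : ∀ {n} → (Fin n → ℤ) → (Fin n → ℤ) → ℚ
  totalHalfDefect m π = sumFin (λ s → ⟦ halfDefect (m s) (π s) ⟧)

  totalHalfDefect-nonNeg : ∀ {n} (m π : Fin n → ℤ) → 0ℚ ≤ totalHalfDefect m π
  totalHalfDefect-nonNeg m π = sumFin-nonNeg _ (λ s → ⟦⟧-mono-≤ (halfDefect-nonNeg (m s) (π s)))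

  totalHalfDefect≡0⇔O1 : ∀ {n} (m π : Fin n → ℤ) → totalHalfDefect m π ≡ 0ℚ ⇔ O1 m π
  totalHalfDefect≡0⇔O1 m π = mk⇔
    (λ G≡0 s → Equivalence.to (halfDefect≡0⇔ (m s) (π s)) (⟦⟧-injective (Equivalence.to Σ≡0⇔ G≡0 s)))
    (λ o1 → Equivalence.from Σ≡0⇔ (λ s → cong ⟦_⟧ (Equivalence.from (halfDefect≡0⇔ (m s) (π s)) (o1 s))))
    where
    Σ≡0⇔ = sumFin≡0⇔ _ (λ s → ⟦⟧-mono-≤ (halfDefect-nonNeg (m s) (π s)))

  ⟦m*m+⌊⌋*⌈⌉⟧≡⟦halfDefect+m*z⟧ : ∀ m z →
    ⟦ m ℤ.* m ⟧ + ⟦ half⌊⌋ z ℤ.* half⌈⌉ z ⟧ ≡ ⟦ halfDefect m z ⟧ + ⟦ m ⟧ * ⟦ z ⟧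
  ⟦m*m+⌊⌋*⌈⌉⟧≡⟦halfDefect+m*z⟧ m z = begin
    ⟦ m ℤ.* m ⟧ + ⟦ f ℤ.* c ⟧    ≡⟨ ⟦⟧-homo-+ (m ℤ.* m) (f ℤ.* c) ⟨
    ⟦ m ℤ.* m ℤ.+ f ℤ.* c ⟧      ≡⟨ cong ⟦_⟧ (m*m+⌊⌋*⌈⌉≡halfDefect+m*z m z) ⟩
    ⟦ halfDefect m z ℤ.+ m ℤ.* z ⟧ ≡⟨ ⟦⟧-homo-+ (halfDefect m z) (m ℤ.* z) ⟩
    ⟦ halfDefect m z ⟧ + ⟦ m ℤ.* z ⟧ ≡⟨ cong (⟦ halfDefect m z ⟧ +_) (⟦⟧-homo-* m z) ⟩
    ⟦ halfDefect m z ⟧ + ⟦ m ⟧ * ⟦ z ⟧ ∎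
    where
    f = half⌊⌋ z
    c = half⌈⌉ z

  sqSum+corr≡totalHalfDefect+Σmπ : ∀ {n} (m π : Fin n → ℤ) →
    sqSum m + corr π ≡ totalHalfDefect m π + sumFin (λ s → ⟦ m s ⟧ * ⟦ π s ⟧)
  sqSum+corr≡totalHalfDefect+Σmπ m π = begin
    sqSum m + corr π
      ≡⟨ sumFin-distrib-+ (λ s → ⟦ m s ℤ.* m s ⟧) (λ s → ⟦ half⌊⌋ (π s) ℤ.* half⌈⌉ (π s) ⟧) ⟨
    sumFin (λ s → ⟦ m s ℤ.* m s ⟧ + ⟦ half⌊⌋ (π s) ℤ.* half⌈⌉ (π s) ⟧)
      ≡⟨ sumFin-cong (λ s → ⟦m*m+⌊⌋*⌈⌉⟧≡⟦halfDefect+m*z⟧ (m s) (π s)) ⟩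
    sumFin (λ s → ⟦ halfDefect (m s) (π s) ⟧ + ⟦ m s ⟧ * ⟦ π s ⟧)
      ≡⟨ sumFin-distrib-+ (λ s → ⟦ halfDefect (m s) (π s) ⟧) (λ s → ⟦ m s ⟧ * ⟦ π s ⟧) ⟩
    totalHalfDefect m π + sumFin (λ s → ⟦ m s ⟧ * ⟦ π s ⟧)
      ∎

  sqSum-decomposition : ∀ {n} (p : SetFun (suc n)) (m π : Fin (suc n) → ℤ) σ →
    sqSum m ≡ (linExt p σ π - corr π) + (totalHalfDefect m π + linExt (slack p m) σ π)
  sqSum-decomposition p m π σ = begin
    sqSum m                            ≡⟨ solve 2 (λ q c → q := (q :+ c) :- c) refl (sqSum m) (corr π) ⟩
    (sqSum m + corr π) - corr π        ≡⟨ cong (_- corr π) (sqSum+corr≡totalHalfDefect+Σmπ m π) ⟩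
    (G + sumFin (λ s → ⟦ m s ⟧ * ⟦ π s ⟧)) - corr π  ≡⟨ cong (λ x → (G + x) - corr π) Σmπ≡ ⟩
    (G + (linExt p σ π + N)) - corr π  ≡⟨ solve 4 (λ g l n c → (g :+ (l :+ n)) :- c := (l :- c) :+ (g :+ n)) refl
                                                   G (linExt p σ π) N (corr π) ⟩
    (linExt p σ π - corr π) + (G + N)  ∎
    where
    G = totalHalfDefect m π
    N = linExt (slack p m) σ π
    t≡q+[t-q] : ∀ t q → t ≡ q + (t - q)
    t≡q+[t-q] = solve 2 (λ t q → t := q :+ (t :- q)) refl
    Σmπ≡ : sumFin (λ s → ⟦ m s ⟧ * ⟦ π s ⟧) ≡ linExt p σ π + N
    Σmπ≡ = begin
      sumFin (λ s → ⟦ m s ⟧ * ⟦ π s ⟧)    ≡⟨ linExt-tilde m σ π ⟨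
      linExt (tilde m) σ π               ≡⟨ linExt-cong σ π (λ Z → t≡q+[t-q] (tilde m Z) (p Z)) ⟩
      linExt (λ Z → p Z + slack p m Z) σ π ≡⟨ linExt-+ p (slack p m) σ π ⟩
      linExt p σ π + N                   ∎

  slack-nonNeg : ∀ {n} (p : SetFun n) m → InB' p m → ∀ Z → 0ℚ ≤ slack p m Z
  slack-nonNeg p m (_ , p≤m̃) Z = 0≤q-p (p≤m̃ Z)

  slack-⊤ : ∀ {n} (p : SetFun n) m → InB' p m → slack p m ⊤ ≡ 0ℚ
  slack-⊤ p m (m̃⊤≡p⊤ , _) = x≈y⇒x∙y⁻¹≈ε m̃⊤≡p⊤

  linExt-slack≡0⇔O2 : ∀ {n} (p : SetFun (suc n)) m π (σ : Permutation′ (suc n)) →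
    SortsDesc π σ → InB' p m → linExt (slack p m) σ π ≡ 0ℚ ⇔ O2 p m π
  linExt-slack≡0⇔O2 p m π σ sorted m∈B = mk⇔
    (λ N≡0 X top → x∙y⁻¹≈ε⇒x≈y _ _ (Equivalence.to tight⇔ N≡0 X top))
    (λ o2 → Equivalence.from tight⇔ (λ X top → x≈y⇒x∙y⁻¹≈ε (o2 X top)))
    where
    tight⇔ = linExt≡0⇔tight π σ sorted (slack-nonNeg p m m∈B) (slack-⊤ p m m∈B)

open import Data.Fin.Subset using (⊥)
open import Data.Rational using (_+_; _-_; _≤_)
open import Data.Product.Function.NonDependent.Propositional using (_×-⇔_)
open import Function.Properties.Equivalence using (⇔-setoid)
open import Level using (0ℓ)

proposition6p17 : (n : ℕ) (p : SetFun (suc n)) → p ⊥ ≡ 0ℚ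
    → (m : Fin (suc n) → ℤ) → InB' p m
    → (π : Fin (suc n) → ℤ) (σ : Permutation′ (suc n)) → SortsDesc π σ
    → (linExt p σ π - corr π ≤ sqSum m)
    × ((sqSum m ≡ linExt p σ π - corr π) ⇔ (O1 m π × O2 p m π))
proposition6p17 n p _ m m∈B π σ sorted = bound , equality
  where
  G = totalHalfDefect m π
  N = linExt (slack p m) σ π
  0≤G : 0ℚ ≤ G
  0≤G = totalHalfDefect-nonNeg m π
  0≤N : 0ℚ ≤ N
  0≤N = linExt-nonNeg π σ sorted (slack-nonNeg p m m∈B) (slack-⊤ p m m∈B)
  decomposition : sqSum m ≡ (linExt p σ π - corr π) + (G + N)
  decomposition = sqSum-decomposition p m π σ
  bound : linExt p σ π - corr π ≤ sqSum m
  bound = subst (_ ≤_) (sym decomposition) (p≤p+q _ (ℚ.+-mono-≤ 0≤G 0≤N))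
  equality : (sqSum m ≡ linExt p σ π - corr π) ⇔ (O1 m π × O2 p m π)
  equality = begin
    (sqSum m ≡ linExt p σ π - corr π)  ≈⟨ x≡y+d⇒[x≡y⇔d≡0] decomposition ⟩
    (G + N ≡ 0ℚ)                       ≈⟨ p+q≡0⇔p≡0×q≡0 0≤G 0≤N ⟩
    (G ≡ 0ℚ × N ≡ 0ℚ)                  ≈⟨ G≡0⇔O1 ×-⇔ N≡0⇔O2 ⟩
    (O1 m π × O2 p m π)                ∎
    where
    open import Relation.Binary.Reasoning.Setoid (⇔-setoid 0ℓ)
    G≡0⇔O1 = totalHalfDefect≡0⇔O1 m π
    N≡0⇔O2 = linExt-slack≡0⇔O2 p m π σ sorted m∈B
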